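{- Let $d\ge 2$ be an integer. For every positive integer $N$, $$\rho_d(N)\le \sum_{k=1}^{d-1}\pi\left(\frac{N}{k}\right)+d\,D\left(\mathbb{Z}_d^{\pi(\sqrt{N})}\right),$$ where $\pi(x)$ denotes the number of primes not exceeding $x$.
   Context: For positive integers $d$ and $N$, $\rho_d(N)$ denotes the maximum size of a set $A\subseteq\{1,2,\dots,N\}$ such that there are no $\ell\ge 1$, pairwise distinct $a_1,\dots,a_\ell\in A$ and integer $x$ with $a_1a_2\cdots a_\ell=x^d$. For a finite abelian group $G$, the Davenport constant $D(G)$ is the smallest positive integer $\ell$ such that every sequence of $\ell$ elements of $G$ (repetitions allowed) contains a non-empty subsequence whose sum is $0$. $\mathbb{Z}_d^m$ denotes the direct sum of $m$ copies of the cyclic group $\mathbb{Z}/d\mathbb{Z}$. -}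

module Defs where

open import Data.Nat using (ℕ; zero; suc; _+_; _*_; _∸_; _^_; _≤_; _<_)
open import Data.Nat.DivMod using (_/_)
open import Data.Nat.Divisibility using (_∣_)
open import Data.Nat.Primality using (prime?)
open import Data.Fin using (Fin; toℕ)
open import Data.Bool using (Bool; true; false; T; if_then_else_)
open import Data.List using (List; []; length; filter; upTo; tabulate)
open import Data.Nat.ListAction using (sum; product)
open import Data.List.Relation.Unary.All using (All)
open import Data.List.Relation.Unary.Unique.Propositional using (Unique)
open import Data.List.Relation.Binary.Sublist.Propositional using (_⊆_)
open import Data.Product using (Σ; ∃; _×_)
open import Relation.Binary.PropositionalEquality using (_≡_; _≢_)
open import Relation.Nullary using (¬_)

primeCount : ℕ → ℕ
primeCount n = length (filter prime? (upTo (suc n)))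

-- Σ_{k=1}^{d-1} π(⌊N/k⌋)   (π(N/k) = π(⌊N/k⌋))
primeSum : ℕ → ℕ → ℕ
primeSum d N = sum (tabulate {n = d ∸ 1} (λ i → primeCount (N / suc (toℕ i))))

-- Elements of Z_d^m are represented as functions Fin m → Fin d.
-- A sequence of length ℓ is s : Fin ℓ → (Fin m → Fin d); a subsequence is
-- given by a selection S : Fin ℓ → Bool of indices.
selSum : ∀ {ℓ} → (Fin ℓ → Bool) → (Fin ℓ → ℕ) → ℕ
selSum S f = sum (tabulate (λ i → if S i then f i else 0))

ZeroSumProperty : ℕ → ℕ → ℕ → Set
ZeroSumProperty d m ℓ =
  (s : Fin ℓ → Fin m → Fin d) →
  Σ (Fin ℓ → Bool) λ S →
    (∃ λ i → T (S i)) ×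
    ((j : Fin m) → d ∣ selSum S (λ i → toℕ (s i j)))

IsDavenport : ℕ → ℕ → ℕ → Set
IsDavenport d m D =
  1 ≤ D × ZeroSumProperty d m D ×
  ((k : ℕ) → 1 ≤ k → ZeroSumProperty d m k → D ≤ k)

ProductFree : ℕ → ℕ → List ℕ → Set
ProductFree d N A =
  Unique A ×
  All (λ a → 1 ≤ a × a ≤ N) A ×
  ((B : List ℕ) → B ⊆ A → B ≢ [] → ¬ (∃ λ x → product B ≡ x ^ d))

module Submission where

-- Write every a ∈ A as a = m · L, where m is a product of primes ≤ r and the cofactor L is 1 or a
-- prime: a ≤ N < (r+1)² leaves room for at most one prime factor > r.  Call a set of at most d
-- elements of A a block if the product of its cofactors is a d-th power: one element with L = 1,
-- or d elements sharing a prime cofactor p.  A set of elements of A containing no block has at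
-- most Σ_{1≤k<d} π(N/k) elements, because the elements with cofactor p are distinct multiples of
-- p, so a k-th one forces k p ≤ N.  Hence if |A| > Σ_{1≤k<d} π(N/k) + d D, one can peel off D
-- disjoint blocks.  The exponent vectors of their smooth parts, read in Z_d^{π(r)}, have a
-- non-empty zero-sum subsequence by the definition of D, and the union of the corresponding blocks
-- is a non-empty subset of A whose product is a d-th power.

open import Defs
open import Algebra.Bundles using (CommutativeMonoid)
open import Data.Bool using (Bool; true; false; T; _∧_; _∨_; not; if_then_else_)
open import Data.Bool.Properties using (T-≡; T-∧; T?; ∧-identityʳ; ∧-zeroʳ)
open import Data.Fin using (Fin; zero; suc; toℕ)
open import Data.Fin.Properties as Fin using (any?; toℕ<n; toℕ-fromℕ<)
open import Data.List using (List; []; _∷_; length; lookup; filter; upTo; applyUpTo; tabulate)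
open import Data.List.Membership.Propositional.Properties using (∈-filter⁺; ∈-upTo⁺; ∈-lookup)
open import Data.List.Relation.Binary.Sublist.Propositional using (_⊆_; []; _∷_; _∷ʳ_)
open import Data.List.Relation.Unary.All as All using (All)
open import Data.List.Relation.Unary.AllPairs using (_∷_)
open import Data.List.Relation.Unary.Any using (index)
open import Data.List.Relation.Unary.Any.Properties using (lookup-index)
open import Data.List.Relation.Unary.Unique.Propositional using (Unique)
open import Data.Nat using (ℕ; zero; suc; _+_; _*_; _∸_; _^_; _≤_; _<_; _≤?_; _≤ᵇ_; _<ᵇ_; _≡ᵇ_;
  z≤n; s≤s; s≤s⁻¹; z<s; NonZero; >-nonZero; >-nonZero⁻¹; nonTrivial⇒n>1)
open import Data.Nat.Properties
open import Algebra.Properties.CommutativeSemigroup *-commutativeSemigroup using (x∙yz≈y∙xz)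
import Algebra.Properties.Semiring.Sum +-*-semiring as Semiring
open import Data.Nat.DivMod
  using (_/_; _%_; _mod_; m*n/n≡m; m/n*n≡m; m/n*n≤m; m/n≤m; /-monoˡ-≤; m≡m%n+[m/n]*n)
open import Data.Nat.Divisibility using (_∣_; divides; _∣?_; ∣⇒≤; ∣m∣n⇒∣m+n)
open import Data.Nat.Induction using (<-wellFounded)
import Data.Nat.ListAction as ListAction
open import Data.Nat.Primality
open import Data.Product using (∃; _×_; _,_; proj₁; proj₂)
open import Data.Sum using (_⊎_; inj₁; inj₂)
open import Data.Vec.Functional using (Vector; foldr; updateAt)
open import Function.Bundles using (Equivalence)
open import Induction.WellFounded using (Acc; acc)
open import Relation.Binary.PropositionalEquality as ≡
  using (_≡_; _≢_; refl; cong; cong₂; sym; trans; module ≡-Reasoning)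
open import Relation.Nullary using (¬_; yes; no; does; contradiction)
open import Relation.Nullary.Decidable using (dec-true)
open import Relation.Unary using (Decidable)

T-true : ∀ {b} → b ≡ true → T b
T-true = Equivalence.from T-≡

T-∧⁻ : ∀ {a b} → T (a ∧ b) → T a × T b
T-∧⁻ {a} = Equivalence.to (T-∧ {a})

T-∧⁺ : ∀ {a b} → T a × T b → T (a ∧ b)
T-∧⁺ = Equivalence.from T-∧

or : ∀ {n} → Vector Bool n → Bool
or = foldr _∨_ false

T-or : ∀ {n} (c : Vector Bool n) k → T (c k) → T (or c)
T-or c zero    cₖ with true ← c zero = _
T-or c (suc k) cₖ with c zero
... | true  = _
... | false = T-or (λ k → c (suc k)) k cₖ

AtMostOne : ∀ {n} → Vector Bool n → Set
AtMostOne c = ∀ k l → T (c k) → T (c l) → k ≡ l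

Disjoint : ∀ {t n} → (Fin t → Vector Bool n) → Set
Disjoint β = ∀ k l i → T (β k i) → T (β l i) → k ≡ l

_⊆ᵇ_ : ∀ {n} → Vector Bool n → Vector Bool n → Set
β ⊆ᵇ M = ∀ i → T (β i) → T (M i)

module BigOperators {c ℓ} (M : CommutativeMonoid c ℓ) where

  open CommutativeMonoid M
    using (Carrier; _≈_; _∙_; ε; setoid; identityˡ; identityʳ; ∙-congˡ)
    renaming (refl to ≈-refl; sym to ≈-sym)
  open import Algebra.Properties.CommutativeMonoid.Sum M public
    using (sum; sum-cong-≋; sum-cong-≗; sum-replicate-zero; ∑-distrib-+; ∑-comm)
  open import Relation.Binary.Reasoning.Setoid setoid

  -- Defined with if_then_else_ so that Defs.selSum is literally a sum of selects.
  select : Bool → Carrier → Carrier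
  select b x = if b then x else ε

  select-∧ : ∀ a b x → select (a ∧ b) x ≡ select a (select b x)
  select-∧ true  _ _ = ≡.refl
  select-∧ false _ _ = ≡.refl

  select-∙ : ∀ b x y → select b (x ∙ y) ≈ select b x ∙ select b y
  select-∙ true  x y = ≈-refl
  select-∙ false x y = ≈-sym (identityˡ ε)

  sum-select : ∀ {n} b (f : Vector Carrier n) → sum (λ i → select b (f i)) ≈ select b (sum f)
  sum-select         true  f = ≈-refl
  sum-select {n = n} false f = sum-replicate-zero n

  sum-select-atMostOne : ∀ {n} (c : Vector Bool n) x → AtMostOne c →
                         sum (λ k → select (c k) x) ≈ select (or c) x
  sum-select-atMostOne {zero}  c x _ = ≈-refl
  sum-select-atMostOne {suc n} c x one with c zero in c₀
  ... | true = begin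
    x ∙ sum (λ k → select (c (suc k)) x) ≈⟨ ∙-congˡ (sum-cong-≋ others) ⟩
    x ∙ sum {n} (λ _ → ε)                ≈⟨ ∙-congˡ (sum-replicate-zero n) ⟩
    x ∙ ε                                ≈⟨ identityʳ x ⟩
    x                                    ∎
    where
    others : ∀ k → select (c (suc k)) x ≈ ε
    others k with c (suc k) in cₖ
    ... | false = ≈-refl
    ... | true with () ← one zero (suc k) (T-true c₀) (T-true cₖ)
  ... | false = begin
    ε ∙ sum (λ k → select (c (suc k)) x) ≈⟨ identityˡ _ ⟩
    sum (λ k → select (c (suc k)) x)     ≈⟨ sum-select-atMostOne (λ k → c (suc k)) x tail-one ⟩
    select (or (λ k → c (suc k))) x      ∎
    where
    tail-one : AtMostOne (λ k → c (suc k))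
    tail-one k l cₖ cₗ = Fin.suc-injective (one (suc k) (suc l) cₖ cₗ)

  sum-select-⋃ : ∀ {t n} (S : Vector Bool t) (β : Fin t → Vector Bool n) → Disjoint β →
                 (f : Vector Carrier n) →
                 sum (λ i → select (or (λ k → S k ∧ β k i)) (f i)) ≈
                 sum (λ k → select (S k) (sum (λ i → select (β k i) (f i))))
  sum-select-⋃ S β disjoint f = begin
    sum (λ i → select (or (λ k → S k ∧ β k i)) (f i))
      ≈⟨ sum-cong-≋ (λ i → ≈-sym (sum-select-atMostOne _ (f i) (one i))) ⟩
    sum (λ i → sum (λ k → select (S k ∧ β k i) (f i)))
      ≈⟨ ∑-comm (λ i k → select (S k ∧ β k i) (f i)) ⟩
    sum (λ k → sum (λ i → select (S k ∧ β k i) (f i)))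
      ≡⟨ sum-cong-≗ (λ k → sum-cong-≗ (λ i → select-∧ (S k) (β k i) (f i))) ⟩
    sum (λ k → sum (λ i → select (S k) (select (β k i) (f i))))
      ≈⟨ sum-cong-≋ (λ k → sum-select (S k) (λ i → select (β k i) (f i))) ⟩
    sum (λ k → select (S k) (sum (λ i → select (β k i) (f i)))) ∎
    where
    one : ∀ i → AtMostOne (λ k → S k ∧ β k i)
    one i k l cₖ cₗ = disjoint k l i (proj₂ (T-∧⁻ cₖ)) (proj₂ (T-∧⁻ cₗ))

module Σ = BigOperators +-0-commutativeMonoid
module Π = BigOperators *-1-commutativeMonoid

-- Counting

count : ∀ {n} → Vector Bool n → ℕ
count C = Σ.sum (λ i → Σ.select (C i) 1)

∑-mono-≤ : ∀ {n} {f g : Vector ℕ n} → (∀ i → f i ≤ g i) → Σ.sum f ≤ Σ.sum g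
∑-mono-≤ {zero}  _   = z≤n
∑-mono-≤ {suc n} f≤g = +-mono-≤ (f≤g zero) (∑-mono-≤ (λ i → f≤g (suc i)))

count-true : ∀ n → count {n} (λ _ → true) ≡ n
count-true zero    = refl
count-true (suc n) = cong suc (count-true n)

count-false : ∀ n → count {n} (λ _ → false) ≡ 0
count-false n = Σ.sum-replicate-zero n

count-none : ∀ {n} (C : Vector Bool n) → (∀ i → ¬ T (C i)) → count C ≡ 0
count-none {n} C none = trans (Σ.sum-cong-≗ {n} vanish) (count-false n)
  where
  vanish : ∀ i → Σ.select (C i) 1 ≡ 0
  vanish i with C i in Cᵢ
  ... | false = refl
  ... | true  = contradiction (T-true Cᵢ) (none i)

count-witness : ∀ {n} (C : Vector Bool n) → 0 < count C → ∃ λ i → T (C i)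
count-witness {suc n} C pos with C zero in C₀
... | true  = zero , T-true C₀
... | false = let i , Cᵢ = count-witness (λ i → C (suc i)) pos in suc i , Cᵢ

witness-count : ∀ {n} (C : Vector Bool n) i → T (C i) → 0 < count C
witness-count C zero    Cᵢ with true ← C zero = s≤s z≤n
witness-count C (suc i) Cᵢ = ≤-trans (witness-count (λ j → C (suc j)) i Cᵢ) (m≤n+m _ _)

count-atMostOne : ∀ {n} (C : Vector Bool n) → AtMostOne C → count C ≤ 1
count-atMostOne C one = ≤-trans (≤-reflexive (Σ.sum-select-atMostOne C 1 one)) (select≤1 (or C))
  where
  select≤1 : ∀ b → Σ.select b 1 ≤ 1
  select≤1 true  = ≤-refl
  select≤1 false = z≤n

count-mono : ∀ {n} {C C′ : Vector Bool n} → C ⊆ᵇ C′ → count C ≤ count C′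
count-mono {C = C} {C′} C⊆C′ = ∑-mono-≤ select-mono
  where
  select-mono : ∀ i → Σ.select (C i) 1 ≤ Σ.select (C′ i) 1
  select-mono i with C i | C′ i | C⊆C′ i
  ... | false | _     | _      = z≤n
  ... | true  | true  | _      = ≤-refl
  ... | true  | false | C⊆C′ᵢ with () ← C⊆C′ᵢ _

count-split : ∀ {n} (M β : Vector Bool n) → β ⊆ᵇ M →
              count M ≡ count (λ i → M i ∧ not (β i)) + count β
count-split {n} M β β⊆M =
  trans (Σ.sum-cong-≗ {n} split)
        (Σ.∑-distrib-+ (λ i → Σ.select (M i ∧ not (β i)) 1) (λ i → Σ.select (β i) 1))
  where
  split : ∀ i → Σ.select (M i) 1 ≡ Σ.select (M i ∧ not (β i)) 1 + Σ.select (β i) 1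
  split i with β i in βᵢ | M i in Mᵢ
  ... | false | false = refl
  ... | false | true  = refl
  ... | true  | true  = refl
  ... | true  | false with () ← ≡.subst T Mᵢ (β⊆M i (T-true βᵢ))

first : ∀ {n} → ℕ → Vector Bool n → Vector Bool n
first         zero    _ _       = false
first {suc n} (suc k) C zero    = C zero
first {suc n} (suc k) C (suc i) = first (if C zero then k else suc k) (λ j → C (suc j)) i

first-⊆ : ∀ {n} k (C : Vector Bool n) → first k C ⊆ᵇ C
first-⊆         zero    C i       ()
first-⊆ {suc n} (suc k) C zero    Cᵢ = Cᵢ
first-⊆ {suc n} (suc k) C (suc i) Cᵢ = first-⊆ (if C zero then k else suc k) (λ j → C (suc j)) i Cᵢ

count-first : ∀ {n} k (C : Vector Bool n) → k ≤ count C → count (first k C) ≡ k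
count-first {n}     zero    C _ = count-false n
count-first {suc n} (suc k) C k≤C with C zero
... | true  = cong suc (count-first k (λ j → C (suc j)) (s≤s⁻¹ k≤C))
... | false = count-first (suc k) (λ j → C (suc j)) k≤C

count-≡ᵇ : ∀ {B} x → x < B → count {B} (λ v → x ≡ᵇ toℕ v) ≡ 1
count-≡ᵇ {suc B} zero    _   = cong suc (count-false B)
count-≡ᵇ {suc B} (suc x) x<B = count-≡ᵇ x (s≤s⁻¹ x<B)

count-fibres : ∀ {n} B (C : Vector Bool n) (g : Vector ℕ n) → (∀ i → T (C i) → g i < B) →
               count C ≡ Σ.sum {B} (λ v → count (λ i → C i ∧ (g i ≡ᵇ toℕ v)))
count-fibres {n} B C g g<B =
  trans (Σ.sum-cong-≗ {n} fibre) (Σ.∑-comm {n} {B} (λ i v → Σ.select (C i ∧ (g i ≡ᵇ toℕ v)) 1))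
  where
  fibre : ∀ i → Σ.select (C i) 1 ≡ Σ.sum {B} (λ v → Σ.select (C i ∧ (g i ≡ᵇ toℕ v)) 1)
  fibre i with C i in Cᵢ
  ... | true  = sym (count-≡ᵇ (g i) (g<B i (T-true Cᵢ)))
  ... | false = sym (count-false B)

pigeonhole : ∀ {n} B (C : Vector Bool n) (g : Vector ℕ n) →
             (∀ i → T (C i) → 0 < g i × g i ≤ B) →
             (∀ i j → T (C i) → T (C j) → g i ≡ g j → i ≡ j) →
             count C ≤ B
pigeonhole B C g bounds injective = begin
  count C                 ≡⟨ count-fibres (suc B) C g (λ i Cᵢ → s≤s (proj₂ (bounds i Cᵢ))) ⟩
  fibre 0 + positive      ≡⟨ cong (_+ positive) (count-none _ no-zero) ⟩
  positive                ≤⟨ ∑-mono-≤ {B} (λ v → count-atMostOne _ (one (suc (toℕ v)))) ⟩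
  count {B} (λ _ → true)  ≡⟨ count-true B ⟩
  B                       ∎
  where
  open ≤-Reasoning
  fibre : ℕ → ℕ
  fibre v = count (λ i → C i ∧ (g i ≡ᵇ v))
  positive = Σ.sum {B} (λ v → fibre (suc (toℕ v)))
  no-zero : ∀ i → ¬ T (C i ∧ (g i ≡ᵇ 0))
  no-zero i cᵢ = let Cᵢ , gᵢ = T-∧⁻ cᵢ in
    <⇒≢ (proj₁ (bounds i Cᵢ)) (sym (≡ᵇ⇒≡ (g i) 0 gᵢ))
  one : ∀ v → AtMostOne (λ i → C i ∧ (g i ≡ᵇ v))
  one v i j cᵢ cⱼ = let Cᵢ , gᵢ = T-∧⁻ cᵢ ; Cⱼ , gⱼ = T-∧⁻ cⱼ in
    injective i j Cᵢ Cⱼ (trans (≡ᵇ⇒≡ (g i) v gᵢ) (sym (≡ᵇ⇒≡ (g j) v gⱼ)))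

count-<ᵇ : ∀ {m} c → c ≤ m → count {m} (λ k → toℕ k <ᵇ c) ≡ c
count-<ᵇ {m}     zero    _   = count-false m
count-<ᵇ {suc m} (suc c) c≤m = cong suc (count-<ᵇ c (s≤s⁻¹ c≤m))

∑-truncate : ∀ {M B} (f : ℕ → ℕ) → M ≤ B → (∀ v → M ≤ v → f v ≡ 0) →
             Σ.sum {B} (λ v → f (toℕ v)) ≡ Σ.sum {M} (λ v → f (toℕ v))
∑-truncate {zero}  {B}     f _   vanish =
  trans (Σ.sum-cong-≗ {B} (λ v → vanish (toℕ v) z≤n)) (count-false B)
∑-truncate {suc M} {suc B} f M≤B vanish =
  cong (f 0 +_) (∑-truncate (λ v → f (suc v)) (s≤s⁻¹ M≤B) (λ v M≤v → vanish (suc v) (s≤s M≤v)))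

length-filter-applyUpTo : ∀ {p} {P : ℕ → Set p} (P? : Decidable P) (f : ℕ → ℕ) B →
  length (filter P? (applyUpTo f B)) ≡ count {B} (λ v → does (P? (f (toℕ v))))
length-filter-applyUpTo P? f zero    = refl
length-filter-applyUpTo P? f (suc B) with does (P? (f 0))
... | true  = cong suc (length-filter-applyUpTo P? (λ v → f (suc v)) B)
... | false = length-filter-applyUpTo P? (λ v → f (suc v)) B

sum-tabulate : ∀ {n} (f : Vector ℕ n) → ListAction.sum (tabulate f) ≡ Σ.sum f
sum-tabulate {zero}  f = refl
sum-tabulate {suc n} f = cong (f zero +_) (sum-tabulate (λ i → f (suc i)))

-- Monomials

^-distribʳ-* : ∀ x y n → (x * y) ^ n ≡ x ^ n * y ^ n
^-distribʳ-* x y zero    = refl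
^-distribʳ-* x y (suc n) = trans (cong (x * y *_) (^-distribʳ-* x y n))
                                 ([m*n]*[o*p]≡[m*o]*[n*p] x y (x ^ n) (y ^ n))

∏-^ : ∀ {t} (f : Vector ℕ t) n → Π.sum (λ k → f k ^ n) ≡ Π.sum f ^ n
∏-^ {zero}  f n = sym (^-zeroˡ n)
∏-^ {suc t} f n = trans (cong (f zero ^ n *_) (∏-^ (λ k → f (suc k)) n))
                        (sym (^-distribʳ-* (f zero) (Π.sum (λ k → f (suc k))) n))

select-^ : ∀ b y n → Π.select b (y ^ n) ≡ Π.select b y ^ n
select-^ true  y n = refl
select-^ false y n = sym (^-zeroˡ n)

∏-select-const : ∀ {n} (C : Vector Bool n) (f : Vector ℕ n) p → (∀ i → T (C i) → f i ≡ p) →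
                 Π.sum (λ i → Π.select (C i) (f i)) ≡ p ^ count C
∏-select-const {zero}  C f p _     = refl
∏-select-const {suc n} C f p const with C zero in C₀
... | true  = cong₂ _*_ (const zero (T-true C₀)) rest
  where rest = ∏-select-const (λ i → C (suc i)) (λ i → f (suc i)) p (λ i → const (suc i))
... | false = trans (*-identityˡ _) rest
  where rest = ∏-select-const (λ i → C (suc i)) (λ i → f (suc i)) p (λ i → const (suc i))

monomial : ∀ {m} → Vector ℕ m → Vector ℕ m → ℕ
monomial q e = Π.sum (λ j → q j ^ e j)

monomial-updateAt-suc : ∀ {m} (q e : Vector ℕ m) i → monomial q (updateAt e i suc) ≡ q i * monomial q e
monomial-updateAt-suc q e zero    = *-assoc (q zero) _ _
monomial-updateAt-suc q e (suc i) =
  trans (cong (q zero ^ e zero *_) (monomial-updateAt-suc (λ j → q (suc j)) (λ j → e (suc j)) i))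
        (x∙yz≈y∙xz (q zero ^ e zero) (q (suc i)) _)

module _ {m} (q : Vector ℕ m) where

  monomial-cong : ∀ {e e′} → (∀ j → e j ≡ e′ j) → monomial q e ≡ monomial q e′
  monomial-cong e≡e′ = Π.sum-cong-≗ {m} (λ j → cong (q j ^_) (e≡e′ j))

  monomial-zero : monomial q (λ _ → 0) ≡ 1
  monomial-zero = Π.sum-replicate-zero m

  monomial-+ : ∀ e e′ → monomial q (λ j → e j + e′ j) ≡ monomial q e * monomial q e′
  monomial-+ e e′ = trans (Π.sum-cong-≗ {m} (λ j → ^-distribˡ-+-* (q j) (e j) (e′ j)))
                          (Π.∑-distrib-+ (λ j → q j ^ e j) (λ j → q j ^ e′ j))

  monomial-∑ : ∀ {t} (E : Fin t → Vector ℕ m) →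
               monomial q (λ j → Σ.sum (λ k → E k j)) ≡ Π.sum (λ k → monomial q (E k))
  monomial-∑ {zero}  E = monomial-zero
  monomial-∑ {suc t} E = trans (monomial-+ (E zero) (λ j → Σ.sum (λ k → E (suc k) j)))
                               (cong (monomial q (E zero) *_) (monomial-∑ (λ k → E (suc k))))

  monomial-select : ∀ b e → monomial q (λ j → Σ.select b (e j)) ≡ Π.select b (monomial q e)
  monomial-select true  e = refl
  monomial-select false e = monomial-zero

  monomial-*ʳ : ∀ e n → monomial q (λ j → e j * n) ≡ monomial q e ^ n
  monomial-*ʳ e n = trans (Π.sum-cong-≗ {m} (λ j → sym (^-*-assoc (q j) (e j) n)))
                          (∏-^ (λ j → q j ^ e j) n)

  monomial-power : ∀ {n} (e : Fin n → Vector ℕ m) (L : Vector ℕ n) d (U : Vector Bool n) →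
    (∀ j → d ∣ Σ.sum (λ i → Σ.select (U i) (e i j))) →
    (∃ λ Y → Π.sum (λ i → Π.select (U i) (L i)) ≡ Y ^ d) →
    ∃ λ x → Π.sum (λ i → Π.select (U i) (monomial q (e i) * L i)) ≡ x ^ d
  monomial-power {n} e L d U d∣ (Y , L≡Yᵈ) = monomial q F * Y , (begin
    Π.sum (λ i → Π.select (U i) (monomial q (e i) * L i))
      ≡⟨ Π.sum-cong-≗ {n} (λ i → Π.select-∙ (U i) (monomial q (e i)) (L i)) ⟩
    Π.sum (λ i → Π.select (U i) (monomial q (e i)) * Π.select (U i) (L i))
      ≡⟨ Π.∑-distrib-+ (λ i → Π.select (U i) (monomial q (e i))) (λ i → Π.select (U i) (L i)) ⟩
    Π.sum (λ i → Π.select (U i) (monomial q (e i))) * Π.sum (λ i → Π.select (U i) (L i))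
      ≡⟨ cong₂ _*_ exponents L≡Yᵈ ⟩
    monomial q (λ j → F j * d) * Y ^ d
      ≡⟨ cong (_* Y ^ d) (monomial-*ʳ F d) ⟩
    monomial q F ^ d * Y ^ d
      ≡⟨ ^-distribʳ-* (monomial q F) Y d ⟨
    (monomial q F * Y) ^ d ∎)
    where
    open ≡-Reasoning
    F : Vector ℕ m
    F j = _∣_.quotient (d∣ j)
    exponents : Π.sum (λ i → Π.select (U i) (monomial q (e i))) ≡ monomial q (λ j → F j * d)
    exponents = begin
      Π.sum (λ i → Π.select (U i) (monomial q (e i)))
        ≡⟨ Π.sum-cong-≗ {n} (λ i → monomial-select (U i) (e i)) ⟨
      Π.sum (λ i → monomial q (λ j → Σ.select (U i) (e i j)))
        ≡⟨ monomial-∑ (λ i j → Σ.select (U i) (e i j)) ⟨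
      monomial q (λ j → Σ.sum (λ i → Σ.select (U i) (e i j)))
        ≡⟨ monomial-cong (λ j → _∣_.equality (d∣ j)) ⟩
      monomial q (λ j → F j * d) ∎

<⇒≤∸1 : ∀ {m n} → m < n → m ≤ n ∸ 1
<⇒≤∸1 {n = suc n} m<n = s≤s⁻¹ m<n

m*n≤o⇒m≤o/n : ∀ {m n o} .{{_ : NonZero n}} → m * n ≤ o → m ≤ o / n
m*n≤o⇒m≤o/n {m} {n} m*n≤o = ≤-trans (≤-reflexive (sym (m*n/n≡m m n))) (/-monoˡ-≤ n m*n≤o)

m≤o/n⇒m*n≤o : ∀ {m n o} .{{_ : NonZero n}} → m ≤ o / n → m * n ≤ o
m≤o/n⇒m*n≤o {m} {n} {o} m≤o/n = ≤-trans (*-monoˡ-≤ n m≤o/n) (m/n*n≤m o n)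

m+n*[1+t]<o+c⇒m+n*t<o : ∀ m n t {o c} → m + n * suc t < o + c → c ≤ n → m + n * t < o
m+n*[1+t]<o+c⇒m+n*t<o m n t {o} {c} lt c≤n = +-cancelʳ-< n (m + n * t) o (begin-strict
  m + n * t + n   ≡⟨ +-assoc m (n * t) n ⟩
  m + (n * t + n) ≡⟨ cong (m +_) (trans (+-comm (n * t) n) (sym (*-suc n t))) ⟩
  m + n * suc t   <⟨ lt ⟩
  o + c           ≤⟨ +-monoʳ-≤ o c≤n ⟩
  o + n           ∎)
  where open ≤-Reasoning

∣-∑-select-% : ∀ {t} d .{{_ : NonZero d}} (S : Vector Bool t) (x : Vector ℕ t) →
  d ∣ Σ.sum (λ k → Σ.select (S k) (x k % d)) → d ∣ Σ.sum (λ k → Σ.select (S k) (x k))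
∣-∑-select-% {t} d S x d∣ =
  ≡.subst (d ∣_) (sym split)
          (∣m∣n⇒∣m+n d∣ (divides (Σ.sum {t} (λ k → Σ.select (S k) (x k / d))) refl))
  where
  pointwise : ∀ k → Σ.select (S k) (x k) ≡ Σ.select (S k) (x k % d) + Σ.select (S k) (x k / d) * d
  pointwise k with S k
  ... | true  = m≡m%n+[m/n]*n (x k) d
  ... | false = refl
  split : Σ.sum (λ k → Σ.select (S k) (x k)) ≡
          Σ.sum (λ k → Σ.select (S k) (x k % d)) + Σ.sum (λ k → Σ.select (S k) (x k / d)) * d
  split = trans (Σ.sum-cong-≗ {t} pointwise)
         (trans (Σ.∑-distrib-+ (λ k → Σ.select (S k) (x k % d)) (λ k → Σ.select (S k) (x k / d) * d))
                (cong (Σ.sum (λ k → Σ.select (S k) (x k % d)) +_)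
                      (sym (Semiring.*-distribʳ-sum d (λ k → Σ.select (S k) (x k / d))))))

-- Primes

primeAtMost : ℕ → ℕ → Bool
primeAtMost M v = does (prime? v) ∧ (v ≤ᵇ M)

count-primeAtMost : ∀ {M N} → M ≤ N → count {suc N} (λ p → primeAtMost M (toℕ p)) ≡ primeCount M
count-primeAtMost {M} {N} M≤N = begin
  Σ.sum {suc N} (λ p → f (toℕ p))             ≡⟨ ∑-truncate f (s≤s M≤N) beyond ⟩
  Σ.sum {suc M} (λ p → f (toℕ p))             ≡⟨ Σ.sum-cong-≗ {suc M} within ⟩
  count {suc M} (λ p → does (prime? (toℕ p))) ≡⟨ length-filter-applyUpTo prime? (λ v → v) (suc M) ⟨
  primeCount M                                 ∎
  where
  open ≡-Reasoning
  f : ℕ → ℕ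
  f v = Σ.select (primeAtMost M v) 1
  beyond : ∀ v → suc M ≤ v → f v ≡ 0
  beyond v M<v with v ≤ᵇ M in v≤M
  ... | true  = contradiction (≤ᵇ⇒≤ v M (T-true v≤M)) (<⇒≱ M<v)
  ... | false = cong (λ b → Σ.select b 1) (∧-zeroʳ (does (prime? v)))
  within : ∀ p → f (toℕ p) ≡ Σ.select (does (prime? (toℕ p))) 1
  within p with toℕ p ≤ᵇ M in p≤M
  ... | true  = cong (λ b → Σ.select b 1) (∧-identityʳ (does (prime? (toℕ p))))
  ... | false = contradiction (≤⇒≤ᵇ (s≤s⁻¹ (toℕ<n p))) (λ t → ≡.subst T p≤M t)

rough-or-primeDivisor : ∀ k a → k Rough a ⊎ ∃ λ p → Prime p × p < k × p ∣ a
rough-or-primeDivisor 0 a = inj₁ 0-rough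
rough-or-primeDivisor 1 a = inj₁ 1-rough
rough-or-primeDivisor 2 a = inj₁ 2-rough
rough-or-primeDivisor (suc k@(suc (suc _))) a with rough-or-primeDivisor k a
... | inj₂ (p , p-prime , p<k , p∣a) = inj₂ (p , p-prime , m<n⇒m<1+n p<k , p∣a)
... | inj₁ k-rough with k ∣? a
...   | yes k∣a = inj₂ (k , rough∧∣⇒prime k-rough k∣a , n<1+n k , k∣a)
...   | no  k∤a = inj₁ (∤⇒rough-suc k∤a k-rough)

rough⇒unit-or-prime : ∀ {k a} → 0 < a → a < k * k → k Rough a → a ≡ 1 ⊎ Prime a
rough⇒unit-or-prime {a = 1}           _ _    _       = inj₁ refl
rough⇒unit-or-prime {a = suc (suc _)} _ a<k² k-rough = inj₂ (rough∧square>⇒prime k-rough a<k²)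

module SmallPrimes (r : ℕ) where

  smallPrime : Fin (primeCount r) → ℕ
  smallPrime = lookup (filter prime? (upTo (suc r)))

  smallPrime-index : ∀ {p} → Prime p → p ≤ r → ∃ λ j → smallPrime j ≡ p
  smallPrime-index p-prime p≤r = index p∈ , sym (lookup-index p∈)
    where
    p∈ = ∈-filter⁺ prime? (∈-upTo⁺ (s≤s p≤r)) p-prime

  record Factorisation (a : ℕ) : Set where
    field
      exponent : Vector ℕ (primeCount r)
      cofactor : ℕ
      equation : a ≡ monomial smallPrime exponent * cofactor
      cofactor-unit-or-prime : cofactor ≡ 1 ⊎ Prime cofactor

  factorise : ∀ a → 0 < a → a < suc r * suc r → Factorisation a
  factorise a = go a (<-wellFounded a)
    where
    go : ∀ a → Acc _<_ a → 0 < a → a < suc r * suc r → Factorisation a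
    go a (acc smaller) 0<a a<r₊² with rough-or-primeDivisor (suc r) a
    ... | inj₁ rough = record
      { exponent = λ _ → 0
      ; cofactor = a
      ; equation = sym (trans (cong (_* a) (monomial-zero smallPrime)) (*-identityˡ a))
      ; cofactor-unit-or-prime = rough⇒unit-or-prime 0<a a<r₊² rough
      }
    ... | inj₂ (p , p-prime , p<1+r , divides a′ a≡a′p) = record
      { exponent = updateAt exponent j suc
      ; cofactor = cofactor
      ; equation = begin
          a                           ≡⟨ a≡a′p ⟩
          a′ * p                      ≡⟨ cong (_* p) equation ⟩
          Q * cofactor * p            ≡⟨ *-comm (Q * cofactor) p ⟩
          p * (Q * cofactor)          ≡⟨ *-assoc p Q cofactor ⟨
          p * Q * cofactor            ≡⟨ cong (λ x → x * Q * cofactor) qⱼ≡p ⟨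
          smallPrime j * Q * cofactor
            ≡⟨ cong (_* cofactor) (monomial-updateAt-suc smallPrime exponent j) ⟨
          monomial smallPrime (updateAt exponent j suc) * cofactor ∎
      ; cofactor-unit-or-prime = cofactor-unit-or-prime
      }
      where
      open ≡-Reasoning
      0<a′ : 0 < a′
      0<a′ = n≢0⇒n>0 (λ a′≡0 → <⇒≢ 0<a (sym (trans a≡a′p (cong (_* p) a′≡0))))
      a′<a : a′ < a
      a′<a = ≡.subst (a′ <_) (sym a≡a′p)
               (m<m*n a′ p {{>-nonZero 0<a′}} (nonTrivial⇒n>1 p {{prime⇒nonTrivial p-prime}}))
      open Factorisation (go a′ (smaller a′<a) 0<a′ (<-trans a′<a a<r₊²))
      Q = monomial smallPrime exponent
      j = proj₁ (smallPrime-index p-prime (s≤s⁻¹ p<1+r))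
      qⱼ≡p = proj₂ (smallPrime-index p-prime (s≤s⁻¹ p<1+r))

-- Cofactors and blocks

module Cofactors (d N : ℕ) {n} (a L : Vector ℕ n)
  (a-injective : ∀ i j → a i ≡ a j → i ≡ j)
  (0<a : ∀ i → 0 < a i) (a≤N : ∀ i → a i ≤ N) (L∣a : ∀ i → L i ∣ a i) where

  fibre : Vector Bool n → ℕ → ℕ
  fibre M p = count (λ i → M i ∧ (L i ≡ᵇ p))

  fibre-member : ∀ (M : Vector Bool n) p i → T (M i ∧ (L i ≡ᵇ p)) → T (M i) × L i ≡ p
  fibre-member M p i t = let Mᵢ , Lᵢ = T-∧⁻ {M i} t in Mᵢ , ≡ᵇ⇒≡ (L i) p Lᵢ

  fibre-witness : ∀ (M : Vector Bool n) p → 0 < fibre M p → ∃ λ i → T (M i) × L i ≡ p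
  fibre-witness M p pos = let i , t = count-witness (λ i → M i ∧ (L i ≡ᵇ p)) pos in
    i , fibre-member M p i t

  L≤N : ∀ i → L i ≤ N
  L≤N i = ≤-trans (∣⇒≤ {{>-nonZero (0<a i)}} (L∣a i)) (a≤N i)

  -- The quotients a / p over the fibre of p are distinct elements of [1, N/p].
  fibre*p≤N : ∀ (M : Vector Bool n) p .{{_ : NonZero p}} → fibre M p * p ≤ N
  fibre*p≤N M p =
    m≤o/n⇒m*n≤o (pigeonhole (N / p) (λ i → M i ∧ (L i ≡ᵇ p)) (λ i → a i / p) bounds injective)
    where
    a≡a/p*p : ∀ {i} → T (M i ∧ (L i ≡ᵇ p)) → a i ≡ a i / p * p
    a≡a/p*p {i} t = sym (m/n*n≡m (≡.subst (_∣ a i) (proj₂ (fibre-member M p i t)) (L∣a i)))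
    bounds : ∀ i → T (M i ∧ (L i ≡ᵇ p)) → 0 < a i / p × a i / p ≤ N / p
    bounds i t = n≢0⇒n>0 (λ a/p≡0 → <⇒≢ (0<a i) (sym (trans (a≡a/p*p {i} t) (cong (_* p) a/p≡0))))
               , /-monoˡ-≤ p (a≤N i)
    injective : ∀ i j → T (M i ∧ (L i ≡ᵇ p)) → T (M j ∧ (L j ≡ᵇ p)) →
                a i / p ≡ a j / p → i ≡ j
    injective i j tᵢ tⱼ eq =
      a-injective i j (trans (a≡a/p*p {i} tᵢ) (trans (cong (_* p) eq) (sym (a≡a/p*p {j} tⱼ))))

  -- A fibre of size c is split into the c levels k < c; level k of the fibre of p requires
  -- (k + 1) p ≤ N, so summing over p first counts the primes up to N / (k + 1).
  count-bound : ∀ M → (∀ i → T (M i) → Prime (L i)) → (∀ i → T (M i) → fibre M (L i) < d) →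
                count M ≤ primeSum d N
  count-bound M M-prime sparse = begin
    count M
      ≡⟨ count-fibres (suc N) M L (λ i _ → s≤s (L≤N i)) ⟩
    Σ.sum {suc N} (λ p → fibre M (toℕ p))
      ≡⟨ Σ.sum-cong-≗ {suc N} (λ p → sym (count-<ᵇ (fibre M (toℕ p)) (fibre≤d∸1 (toℕ p)))) ⟩
    Σ.sum {suc N} (λ p → count {d ∸ 1} (λ k → toℕ k <ᵇ fibre M (toℕ p)))
      ≤⟨ ∑-mono-≤ {suc N} (λ p → count-mono {d ∸ 1} (λ k → level (toℕ p) (toℕ k))) ⟩
    Σ.sum {suc N} (λ p → count {d ∸ 1} (λ k → primeAtMost (N / suc (toℕ k)) (toℕ p)))
      ≡⟨ Σ.∑-comm {suc N} {d ∸ 1} (λ p k → Σ.select (primeAtMost (N / suc (toℕ k)) (toℕ p)) 1) ⟩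
    Σ.sum {d ∸ 1} (λ k → count {suc N} (λ p → primeAtMost (N / suc (toℕ k)) (toℕ p)))
      ≡⟨ Σ.sum-cong-≗ {d ∸ 1} (λ k → count-primeAtMost (m/n≤m N (suc (toℕ k)))) ⟩
    Σ.sum {d ∸ 1} (λ k → primeCount (N / suc (toℕ k)))
      ≡⟨ sum-tabulate {d ∸ 1} (λ k → primeCount (N / suc (toℕ k))) ⟨
    primeSum d N ∎
    where
    open ≤-Reasoning
    fibre≤d∸1 : ∀ p → fibre M p ≤ d ∸ 1
    fibre≤d∸1 p with fibre M p in fibre≡
    ... | zero  = z≤n
    ... | suc c = let i , Mᵢ , Lᵢ≡p = fibre-witness M p (≡.subst (0 <_) (sym fibre≡) z<s) in
      <⇒≤∸1 (≡.subst (_< d) (trans (cong (fibre M) Lᵢ≡p) fibre≡) (sparse i Mᵢ))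
    level : ∀ p k → T (k <ᵇ fibre M p) → T (primeAtMost (N / suc k) p)
    level p k k<fibre = T-∧⁺ (T-true (dec-true (prime? p) p-prime) , ≤⇒≤ᵇ p≤N/k+1)
      where
      k<f = <ᵇ⇒< k (fibre M p) k<fibre
      witness = fibre-witness M p (≤-<-trans z≤n k<f)
      p-prime : Prime p
      p-prime = ≡.subst Prime (proj₂ (proj₂ witness)) (M-prime (proj₁ witness) (proj₁ (proj₂ witness)))
      instance _ = prime⇒nonZero p-prime
      p≤N/k+1 : p ≤ N / suc k
      p≤N/k+1 = m*n≤o⇒m≤o/n (begin
        p * suc k       ≡⟨ *-comm p (suc k) ⟩
        suc k * p       ≤⟨ *-monoˡ-≤ p k<f ⟩
        fibre M p * p   ≤⟨ fibre*p≤N M p ⟩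
        N               ∎)

  record Block (β : Vector Bool n) : Set where
    field
      nonempty : 0 < count β
      small    : count β ≤ d
      power    : ∃ λ y → Π.sum (λ i → Π.select (β i) (L i)) ≡ y ^ d

  record Blocks (t : ℕ) (M : Vector Bool n) : Set where
    field
      block    : Fin t → Vector Bool n
      block⊆M  : ∀ k → block k ⊆ᵇ M
      disjoint : Disjoint block
      isBlock  : ∀ k → Block (block k)

  module _ (0<d : 0 < d) (L-unit-or-prime : ∀ i → L i ≡ 1 ⊎ Prime (L i)) where

    uniform-block : ∀ M p k → 0 < k → k ≤ d → k ≤ fibre M p → (∃ λ y → p ^ k ≡ y ^ d) →
                    ∃ λ β → β ⊆ᵇ M × Block β
    uniform-block M p k 0<k k≤d k≤fibre (y , pᵏ≡yᵈ) = β , β⊆M , record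
      { nonempty = ≡.subst (0 <_) (sym count≡k) 0<k
      ; small    = ≡.subst (_≤ d) (sym count≡k) k≤d
      ; power    = y , trans (∏-select-const β L p (λ i βᵢ → proj₂ (member i βᵢ)))
                             (trans (cong (p ^_) count≡k) pᵏ≡yᵈ)
      }
      where
      β = first k (λ i → M i ∧ (L i ≡ᵇ p))
      count≡k = count-first k (λ i → M i ∧ (L i ≡ᵇ p)) k≤fibre
      member : ∀ i → T (β i) → T (M i) × L i ≡ p
      member i βᵢ = fibre-member M p i (first-⊆ k _ i βᵢ)
      β⊆M : β ⊆ᵇ M
      β⊆M i βᵢ = proj₁ (member i βᵢ)

    block-in : ∀ M → primeSum d N < count M → ∃ λ β → β ⊆ᵇ M × Block β
    block-in M large with any? (λ i → T? (M i ∧ (L i ≡ᵇ 1)))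
    ... | yes (i , unit) =
      uniform-block M 1 1 z<s 0<d (witness-count (λ i → M i ∧ (L i ≡ᵇ 1)) i unit) (1 , sym (^-zeroˡ d))
    ... | no no-unit with any? (λ i → T? (M i ∧ (d ≤ᵇ fibre M (L i))))
    ...   | yes (i , crowded) =
      uniform-block M (L i) d 0<d ≤-refl (≤ᵇ⇒≤ d _ (proj₂ (T-∧⁻ {M i} crowded))) (L i , refl)
    ...   | no no-crowded = contradiction (count-bound M M-prime sparse) (<⇒≱ large)
      where
      M-prime : ∀ i → T (M i) → Prime (L i)
      M-prime i Mᵢ with L-unit-or-prime i
      ... | inj₂ Lᵢ-prime = Lᵢ-prime
      ... | inj₁ Lᵢ≡1     =
        contradiction (i , T-∧⁺ (Mᵢ , ≡⇒≡ᵇ (L i) 1 Lᵢ≡1)) no-unit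
      sparse : ∀ i → T (M i) → fibre M (L i) < d
      sparse i Mᵢ =
        ≰⇒> (λ d≤fibre → no-crowded (i , T-∧⁺ (Mᵢ , ≤⇒≤ᵇ d≤fibre)))

    blocks : ∀ t M → primeSum d N + d * t < count M → Blocks t M
    blocks zero    M _     = record { block = λ () ; block⊆M = λ () ; disjoint = λ () ; isBlock = λ () }
    blocks (suc t) M large = record
      { block = block ; block⊆M = block⊆M ; disjoint = disjoint ; isBlock = isBlock }
      where
      found = block-in M (≤-<-trans (m≤m+n _ _) large)
      β = proj₁ found
      β⊆M = proj₁ (proj₂ found)
      M′ : Vector Bool n
      M′ i = M i ∧ not (β i)
      module Rest = Blocks (blocks t M′ (m+n*[1+t]<o+c⇒m+n*t<o (primeSum d N) d t
        (≡.subst (primeSum d N + d * suc t <_) (count-split M β β⊆M) large)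
        (Block.small (proj₂ (proj₂ found)))))
      block : Fin (suc t) → Vector Bool n
      block zero    = β
      block (suc k) = Rest.block k
      in-M′ : ∀ k i → T (Rest.block k i) → T (M i) × T (not (β i))
      in-M′ k i t = T-∧⁻ {M i} (Rest.block⊆M k i t)
      block⊆M : ∀ k → block k ⊆ᵇ M
      block⊆M zero        = β⊆M
      block⊆M (suc k) i t = proj₁ (in-M′ k i t)
      outside-β : ∀ k i → T (Rest.block k i) → ¬ T (β i)
      outside-β k i t with β i | proj₂ (in-M′ k i t)
      ... | false | _ = λ ()
      disjoint : Disjoint block
      disjoint zero    zero    i _ _ = refl
      disjoint zero    (suc l) i s t = contradiction s (outside-β l i t)
      disjoint (suc k) zero    i s t = contradiction t (outside-β k i s)
      disjoint (suc k) (suc l) i s t = cong suc (Rest.disjoint k l i s t)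
      isBlock : ∀ k → Block (block k)
      isBlock zero    = proj₂ (proj₂ found)
      isBlock (suc k) = Rest.isBlock k

Unique⇒lookup-injective : ∀ {xs : List ℕ} → Unique xs →
                          ∀ i j → lookup xs i ≡ lookup xs j → i ≡ j
Unique⇒lookup-injective (_  ∷ _) zero    zero    _  = refl
Unique⇒lookup-injective (x∉ ∷ _) zero    (suc j) eq = contradiction eq (All.lookup x∉ (∈-lookup j))
Unique⇒lookup-injective (x∉ ∷ _) (suc i) zero    eq = contradiction (sym eq) (All.lookup x∉ (∈-lookup i))
Unique⇒lookup-injective (_  ∷ u) (suc i) (suc j) eq = cong suc (Unique⇒lookup-injective u i j eq)

pick : ∀ (xs : List ℕ) → Vector Bool (length xs) → List ℕ
pick []       _ = []
pick (x ∷ xs) P with P zero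
... | true  = x ∷ pick xs (λ i → P (suc i))
... | false = pick xs (λ i → P (suc i))

pick-⊆ : ∀ xs P → pick xs P ⊆ xs
pick-⊆ []       P = []
pick-⊆ (x ∷ xs) P with P zero
... | true  = refl ∷ pick-⊆ xs (λ i → P (suc i))
... | false = x ∷ʳ pick-⊆ xs (λ i → P (suc i))

pick-nonempty : ∀ xs P i → T (P i) → pick xs P ≢ []
pick-nonempty (x ∷ xs) P zero    Pᵢ with true ← P zero = λ ()
pick-nonempty (x ∷ xs) P (suc i) Pᵢ with P zero
... | true  = λ ()
... | false = pick-nonempty xs (λ i → P (suc i)) i Pᵢ

product-pick : ∀ xs P → ListAction.product (pick xs P) ≡ Π.sum (λ i → Π.select (P i) (lookup xs i))
product-pick []       P = refl
product-pick (x ∷ xs) P with P zero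
... | true  = cong (x *_) (product-pick xs (λ i → P (suc i)))
... | false = trans (product-pick xs (λ i → P (suc i))) (sym (*-identityˡ _))

module PowerSubproduct (d N r D : ℕ) .{{_ : NonZero d}} (N<r₊² : N < suc r * suc r)
  (zero-sum : ZeroSumProperty d (primeCount r) D)
  (A : List ℕ) (unique : Unique A) (bounds : All (λ a → 1 ≤ a × a ≤ N) A) where

  open SmallPrimes r

  a : Vector ℕ (length A)
  a = lookup A

  a-bounds : ∀ i → 1 ≤ a i × a i ≤ N
  a-bounds i = All.lookup bounds (∈-lookup i)

  open module Factorisationᵢ i = Factorisation
    (factorise (a i) (proj₁ (a-bounds i)) (≤-<-trans (proj₂ (a-bounds i)) N<r₊²))

  open Cofactors d N a cofactor (Unique⇒lookup-injective unique)
                 (λ i → proj₁ (a-bounds i)) (λ i → proj₂ (a-bounds i))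
                 (λ i → divides (monomial smallPrime (exponent i)) (equation i))

  power-subproduct : primeSum d N + d * D < length A →
                     ∃ λ B → B ⊆ A × B ≢ [] × ∃ λ x → ListAction.product B ≡ x ^ d
  power-subproduct long = pick A U , pick-⊆ A U , pick-nonempty A U i₀ U-i₀ , power
    where
    open Blocks (blocks (>-nonZero⁻¹ d) cofactor-unit-or-prime D (λ _ → true)
                        (≡.subst (_ <_) (sym (count-true (length A))) long))
    E : Fin D → Vector ℕ (primeCount r)
    E k j = Σ.sum (λ i → Σ.select (block k i) (exponent i j))
    y : Fin D → ℕ
    y k = proj₁ (Block.power (isBlock k))
    selection = zero-sum (λ k j → E k j mod d)
    S = proj₁ selection
    k₀ = proj₁ (proj₁ (proj₂ selection))
    member = count-witness (block k₀) (Block.nonempty (isBlock k₀))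
    i₀ = proj₁ member
    U : Vector Bool (length A)
    U i = or (λ k → S k ∧ block k i)
    U-i₀ : T (U i₀)
    U-i₀ = T-or _ k₀ (T-∧⁺ (proj₂ (proj₁ (proj₂ selection)) , proj₂ member))
    U-exponents : ∀ j → d ∣ Σ.sum (λ i → Σ.select (U i) (exponent i j))
    U-exponents j = ≡.subst (d ∣_) (sym (Σ.sum-select-⋃ S block disjoint (λ i → exponent i j)))
      (∣-∑-select-% d S (λ k → E k j) (≡.subst (d ∣_) residues (proj₂ (proj₂ selection) j)))
      where
      residues : selSum S (λ k → toℕ (E k j mod d)) ≡ Σ.sum (λ k → Σ.select (S k) (E k j % d))
      residues = trans (sum-tabulate {D} (λ k → Σ.select (S k) (toℕ (E k j mod d))))
                       (Σ.sum-cong-≗ {D} (λ k → cong (Σ.select (S k)) (toℕ-fromℕ< _)))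
    U-cofactors : Π.sum (λ i → Π.select (U i) (cofactor i)) ≡ Π.sum (λ k → Π.select (S k) (y k)) ^ d
    U-cofactors = begin
      Π.sum (λ i → Π.select (U i) (cofactor i))
        ≡⟨ Π.sum-select-⋃ S block disjoint cofactor ⟩
      Π.sum (λ k → Π.select (S k) (Π.sum (λ i → Π.select (block k i) (cofactor i))))
        ≡⟨ Π.sum-cong-≗ {D} (λ k → cong (Π.select (S k)) (proj₂ (Block.power (isBlock k)))) ⟩
      Π.sum (λ k → Π.select (S k) (y k ^ d))
        ≡⟨ Π.sum-cong-≗ {D} (λ k → select-^ (S k) (y k) d) ⟩
      Π.sum (λ k → Π.select (S k) (y k) ^ d)
        ≡⟨ ∏-^ (λ k → Π.select (S k) (y k)) d ⟩
      Π.sum (λ k → Π.select (S k) (y k)) ^ d ∎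
      where open ≡-Reasoning
    power : ∃ λ x → ListAction.product (pick A U) ≡ x ^ d
    power = let x , U-power = monomial-power smallPrime exponent cofactor d U U-exponents (_ , U-cofactors) in
      x , trans (product-pick A U)
                (trans (Π.sum-cong-≗ {length A} (λ i → cong (Π.select (U i)) (equation i))) U-power)

theorem5 : (d : ℕ) → 2 ≤ d → (N : ℕ) → 1 ≤ N →
    (r : ℕ) → r * r ≤ N → N < suc r * suc r →
    (D : ℕ) → IsDavenport d (primeCount r) D →
    (A : List ℕ) → ProductFree d N A →
    length A ≤ primeSum d N + d * D
theorem5 d 2≤d N _ r _ N<r₊² D (_ , zero-sum , _) A (unique , bounds , power-free)
  with length A ≤? primeSum d N + d * D
... | yes short = short
... | no  long  =
  let B , B⊆A , B≢[] , power = power-subproduct (≰⇒> long)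
  in  contradiction power (power-free B B⊆A B≢[])
  where
  instance _ = >-nonZero (≤-trans (s≤s z≤n) 2≤d)
  open PowerSubproduct d N r D N<r₊² zero-sum A unique bounds
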